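{- Let $m\geq 1$ be an integer. For every integer $n\ge 0$, \[ \phi_{n}\!\left(\frac{x}{m}\right)=\frac{1}{m^{n}}\sum_{i=0}^{n}\binom{n}{i}(-1)^{n-i}D_{m}(i,x). \]
   Context: For a positive integer $m$, $W_{m}(n,k)=\frac{1}{m^{k}k!}\sum_{i=0}^{k}\binom{k}{i}(-1)^{k-i}(mi+1)^{n}$ are the Whitney numbers of the second kind of Dowling lattices, and the Dowling polynomials are $D_m(n,x)=\sum_{k=0}^{n}W_m(n,k)x^k$. The Bell polynomials are $\phi_n(x)=\sum_{k=0}^{n}S(n,k)x^k$, with $S(n,k)$ the Stirling numbers of the second kind. -}

module Defs where

open import Data.Nat as ℕ using (ℕ; zero; suc; _∸_; _!; NonZero)
open import Data.Nat.Properties using (m^n≢0; _!≢0; m*n≢0)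
open import Data.Nat.Combinatorics using (_C_)
open import Data.Integer using (+_)
open import Data.Rational using (ℚ; 0ℚ; 1ℚ; _+_; _*_; -_; _/_)

ℕ→ℚ : ℕ → ℚ
ℕ→ℚ n = (+ n) / 1

_^ℚ_ : ℚ → ℕ → ℚ
x ^ℚ zero  = 1ℚ
x ^ℚ suc n = x * (x ^ℚ n)

sumTo : ℕ → (ℕ → ℚ) → ℚ
sumTo zero    f = f 0
sumTo (suc n) f = sumTo n f + f (suc n)

inv : (d : ℕ) → .{{NonZero d}} → ℚ
inv d = (+ 1) / d

S : ℕ → ℕ → ℕ
S zero    zero    = 1
S zero    (suc k) = 0
S (suc n) zero    = 0
S (suc n) (suc k) = suc k ℕ.* S n (suc k) ℕ.+ S n k

φ : ℕ → ℚ → ℚ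
φ n x = sumTo n (λ k → ℕ→ℚ (S n k) * (x ^ℚ k))

W : (m : ℕ) → .{{NonZero m}} → ℕ → ℕ → ℚ
W m n k =
  inv (m ℕ.^ k ℕ.* k !) {{m*n≢0 _ _ {{m^n≢0 m k}} {{k !≢0}}}}
  * sumTo k (λ i → ℕ→ℚ (k C i) * ((- 1ℚ) ^ℚ (k ∸ i)) * (ℕ→ℚ (m ℕ.* i ℕ.+ 1) ^ℚ n))

D : (m : ℕ) → .{{NonZero m}} → ℕ → ℚ → ℚ
D m n x = sumTo n (λ k → W m n k * (x ^ℚ k))

module Submission where

-- Write  Δ_{a,b}(n,k) = Σ_{j≤k} C(k,j) (-1)^{k-j} (aj+b)^n  for the k-th forward
-- difference at 0 of j ↦ (aj+b)^n; by definition  W_m(n,k) = Δ_{m,1}(n,k) / (m^k k!).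
-- The proof rests on three facts about Δ:
--   * the recurrence  Δ(n+1,k+1) = (b + a(k+1)) Δ(n,k+1) + a(k+1) Δ(n,k),  which gives
--     Δ_{a,b}(n,k) = 0 for n < k  and  Δ_{1,0}(n,k) = k! S(n,k);
--   * binomial inversion in the shift:  Σ_i C(n,i)(-1)^{n-i} Δ_{a,b+1}(i,k) = Δ_{a,b}(n,k),
--     because  Σ_i C(n,i)(-1)^{n-i} (aj+b+1)^i = (aj+b)^n;
--   * scaling:  Δ_{a,0}(n,k) = a^n Δ_{1,0}(n,k).
-- Together they give  Σ_i C(n,i)(-1)^{n-i} W_m(i,k) = m^n S(n,k) / m^k.  The theorem
-- follows by extending every D_m(i,x) (i ≤ n) to a sum over k ≤ n, exchanging the two
-- sums and dividing by m^n.

open import Defs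
open import Data.Nat as ℕ using (ℕ; zero; suc; _∸_; NonZero; _!; _≤_; _<_; z≤n; s≤s)
import Data.Nat
import Data.Nat.Properties as ℕP
open import Data.Nat.Properties using (m^n≢0; _!≢0; m*n≢0)
import Data.Nat.Tactic.RingSolver as ℕ-Solver
open import Data.Nat.Combinatorics using (_C_; k>n⇒nCk≡0; nCk+nC[k+1]≡[n+1]C[k+1]; nC1≡n)
open import Data.Nat.Coprimality using (1-coprimeTo) renaming (sym to coprime-sym)
open import Data.Integer using (+_)
import Data.Integer.Properties as ℤP
open import Data.Rational using (ℚ; 0ℚ; 1ℚ; _+_; _*_; -_; _/_; mkℚ; _≟_)
open import Data.Rational.Properties
  using ( normalize-coprime; +-*-commutativeRing; +-*-ring; *-inverseˡ; *-zeroˡ; *-zeroʳ; +-identityʳ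
        ; +-assoc; *-comm; *-identityˡ; *-identityʳ; *-distribˡ-+)
open import Data.Fin using (Fin; toℕ)
open import Data.Sum using (inj₁; inj₂)
open import Relation.Nullary.Decidable.Core using (dec⇒maybe)
open import Function using (_∘_)
open import Algebra.Bundles using (CommutativeRing)
open import Tactic.RingSolver using (solve-∀)
open import Tactic.RingSolver.Core.AlmostCommutativeRing using (AlmostCommutativeRing; fromCommutativeRing)
open import Relation.Binary.PropositionalEquality
open ≡-Reasoning

open CommutativeRing +-*-commutativeRing
  using (+-monoid; +-rawMonoid; semiring; commutativeSemiring; *-commutativeSemigroup)
open import Algebra.Properties.Monoid.Sum +-monoid using (sum; sum-cong-≗)
open import Algebra.Definitions.RawMonoid +-rawMonoid using (_×_)
open import Algebra.Properties.Semiring.Exp semiring using (_^_)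
open import Algebra.Properties.CommutativeSemiring.Exp commutativeSemiring using (^-distrib-*)
import Algebra.Properties.CommutativeSemiring.Binomial commutativeSemiring as Binomial
open import Algebra.Properties.CommutativeSemigroup *-commutativeSemigroup using (x∙yz≈y∙xz; x∙yz≈z∙xy)
open import Algebra.Properties.Ring +-*-ring using (-1*x≈-x)

ℚ-ring : AlmostCommutativeRing _ _
ℚ-ring = fromCommutativeRing +-*-commutativeRing (λ x → dec⇒maybe (0ℚ ≟ x))

ℕ→ℚ-as-mkℚ : ∀ n → ℕ→ℚ n ≡ mkℚ (+ n) 0 (coprime-sym (1-coprimeTo n))
ℕ→ℚ-as-mkℚ n = normalize-coprime (coprime-sym (1-coprimeTo n))

ℕ→ℚ-+ : ∀ a b → ℕ→ℚ (a ℕ.+ b) ≡ ℕ→ℚ a + ℕ→ℚ b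
ℕ→ℚ-+ a b =
  trans (cong (_/ 1) (sym (cong₂ Data.Integer._+_ (ℤP.*-identityʳ (+ a)) (ℤP.*-identityʳ (+ b)))))
        (sym (cong₂ _+_ (ℕ→ℚ-as-mkℚ a) (ℕ→ℚ-as-mkℚ b)))

ℕ→ℚ-* : ∀ a b → ℕ→ℚ (a ℕ.* b) ≡ ℕ→ℚ a * ℕ→ℚ b
ℕ→ℚ-* a b = trans (cong (_/ 1) (ℤP.pos-* a b)) (sym (cong₂ _*_ (ℕ→ℚ-as-mkℚ a) (ℕ→ℚ-as-mkℚ b)))

ℕ→ℚ-^ : ∀ a n → ℕ→ℚ (a ℕ.^ n) ≡ ℕ→ℚ a ^ℚ n
ℕ→ℚ-^ a zero    = refl
ℕ→ℚ-^ a (suc n) = trans (ℕ→ℚ-* a (a ℕ.^ n)) (cong (ℕ→ℚ a *_) (ℕ→ℚ-^ a n))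

ℕ→ℚ-bilinear : ∀ a b c d → ℕ→ℚ a * ℕ→ℚ b + ℕ→ℚ c * ℕ→ℚ d ≡ ℕ→ℚ (a ℕ.* b ℕ.+ c ℕ.* d)
ℕ→ℚ-bilinear a b c d =
  sym (trans (ℕ→ℚ-+ (a ℕ.* b) (c ℕ.* d)) (cong₂ _+_ (ℕ→ℚ-* a b) (ℕ→ℚ-* c d)))

inv-as-mkℚ : ∀ d → inv (suc d) ≡ mkℚ (+ 1) d (1-coprimeTo (suc d))
inv-as-mkℚ d = normalize-coprime (1-coprimeTo (suc d))

inv-* : ∀ a b .{{_ : NonZero a}} .{{_ : NonZero b}} .{{_ : NonZero (a ℕ.* b)}} →
        inv (a ℕ.* b) ≡ inv a * inv b
inv-* (suc a) (suc b) = sym (cong₂ _*_ (inv-as-mkℚ a) (inv-as-mkℚ b))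

inv-^ : ∀ m .{{_ : NonZero m}} n → inv (m ℕ.^ n) {{m^n≢0 m n}} ≡ inv m ^ℚ n
inv-^ m zero    = refl
inv-^ m {{m≢0}} (suc n) =
  trans (inv-* m (m ℕ.^ n) {{m≢0}} {{m^n≢0 m n}} {{m^n≢0 m (suc n)}}) (cong (inv m *_) (inv-^ m n))

inv-cancel : ∀ d .{{_ : NonZero d}} → inv d * ℕ→ℚ d ≡ 1ℚ
inv-cancel (suc d) =
  trans (cong₂ _*_ (inv-as-mkℚ d) (ℕ→ℚ-as-mkℚ (suc d)))
        (*-inverseˡ (mkℚ (+ suc d) 0 (coprime-sym (1-coprimeTo (suc d)))))

1^n≡1 : ∀ n → 1ℚ ^ℚ n ≡ 1ℚ
1^n≡1 zero    = refl
1^n≡1 (suc n) = cong (1ℚ *_) (1^n≡1 n)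

sum-cong : ∀ n {f g : ℕ → ℚ} → (∀ i → i ≤ n → f i ≡ g i) → sumTo n f ≡ sumTo n g
sum-cong zero    f≡g = f≡g 0 z≤n
sum-cong (suc n) f≡g =
  cong₂ _+_ (sum-cong n (λ i i≤n → f≡g i (ℕP.m≤n⇒m≤1+n i≤n))) (f≡g (suc n) ℕP.≤-refl)

sum-+ : ∀ n (f g : ℕ → ℚ) → sumTo n (λ i → f i + g i) ≡ sumTo n f + sumTo n g
sum-+ zero    f g = refl
sum-+ (suc n) f g =
  trans (cong (_+ (f (suc n) + g (suc n))) (sum-+ n f g))
        (interchange (sumTo n f) (sumTo n g) (f (suc n)) (g (suc n)))
  where
  interchange : ∀ a b c d → (a + b) + (c + d) ≡ (a + c) + (b + d)
  interchange = solve-∀ ℚ-ring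

sum-*ˡ : ∀ n c (f : ℕ → ℚ) → c * sumTo n f ≡ sumTo n (λ i → c * f i)
sum-*ˡ zero    c f = refl
sum-*ˡ (suc n) c f =
  trans (*-distribˡ-+ c (sumTo n f) (f (suc n))) (cong (_+ c * f (suc n)) (sum-*ˡ n c f))

sum-swap : ∀ n k (f : ℕ → ℕ → ℚ) →
           sumTo n (λ i → sumTo k (f i)) ≡ sumTo k (λ j → sumTo n (λ i → f i j))
sum-swap zero    k f = refl
sum-swap (suc n) k f =
  trans (cong (_+ sumTo k (f (suc n))) (sum-swap n k f))
        (sym (sum-+ k (λ j → sumTo n (λ i → f i j)) (f (suc n))))

sum-swap-weighted : ∀ n k (c : ℕ → ℚ) (f : ℕ → ℕ → ℚ) →
  sumTo n (λ i → c i * sumTo k (f i)) ≡ sumTo k (λ j → sumTo n (λ i → c i * f i j))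
sum-swap-weighted n k c f =
  trans (sum-cong n (λ i _ → sum-*ˡ k (c i) (f i))) (sum-swap n k (λ i j → c i * f i j))

sum-first : ∀ n (f : ℕ → ℚ) → sumTo (suc n) f ≡ f 0 + sumTo n (f ∘ suc)
sum-first zero    f = refl
sum-first (suc n) f =
  trans (cong (_+ f (suc (suc n))) (sum-first n f))
        (+-assoc (f 0) (sumTo n (f ∘ suc)) (f (suc (suc n))))

sum-extend : ∀ {i} n (f : ℕ → ℚ) → (∀ j → i < j → f j ≡ 0ℚ) → i ≤ n → sumTo i f ≡ sumTo n f
sum-extend zero    f _    z≤n  = refl
sum-extend (suc n) f tail i≤1+n with ℕP.m≤n⇒m<n∨m≡n i≤1+n
... | inj₂ refl       = refl
... | inj₁ (s≤s i≤n) = begin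
  _                     ≡⟨ sum-extend n f tail i≤n ⟩
  sumTo n f             ≡⟨ +-identityʳ (sumTo n f) ⟨
  sumTo n f + 0ℚ        ≡⟨ cong (λ t → sumTo n f + t) (tail (suc n) (s≤s i≤n)) ⟨
  sumTo n f + f (suc n) ∎

sumTo-as-sum : ∀ n (f : ℕ → ℚ) → sumTo n f ≡ sum (λ (i : Fin (suc n)) → f (toℕ i))
sumTo-as-sum zero    f = sym (+-identityʳ (f 0))
sumTo-as-sum (suc n) f = trans (sum-first n f) (cong (λ t → f 0 + t) (sumTo-as-sum n (f ∘ suc)))

×-as-ℕ→ℚ : ∀ n x → n × x ≡ ℕ→ℚ n * x
×-as-ℕ→ℚ zero    x = sym (*-zeroˡ x)
×-as-ℕ→ℚ (suc n) x =
  trans (cong (λ t → x + t) (×-as-ℕ→ℚ n x))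
        (trans (collect x (ℕ→ℚ n)) (cong (_* x) (sym (ℕ→ℚ-+ 1 n))))
  where
  collect : ∀ x N → x + N * x ≡ (1ℚ + N) * x
  collect = solve-∀ ℚ-ring

^-as-^ℚ : ∀ x n → x ^ n ≡ x ^ℚ n
^-as-^ℚ x zero    = refl
^-as-^ℚ x (suc n) = cong (x *_) (^-as-^ℚ x n)

^ℚ-distrib-* : ∀ x y n → (x * y) ^ℚ n ≡ x ^ℚ n * y ^ℚ n
^ℚ-distrib-* x y n =
  trans (sym (^-as-^ℚ (x * y) n)) (trans (^-distrib-* x y n) (cong₂ _*_ (^-as-^ℚ x n) (^-as-^ℚ y n)))

binomial : ∀ n u v → (u + v) ^ℚ n ≡ sumTo n (λ i → ℕ→ℚ (n C i) * (u ^ℚ i * v ^ℚ (n ∸ i)))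
binomial n u v = begin
  (u + v) ^ℚ n                 ≡⟨ ^-as-^ℚ (u + v) n ⟨
  (u + v) ^ n                  ≡⟨ Binomial.theorem n u v ⟩
  Binomial.binomialExpansion u v n
    ≡⟨ sum-cong-≗ {suc n} (λ i → term (toℕ i)) ⟩
  sum (λ (i : Fin (suc n)) → binomialTerm (toℕ i)) ≡⟨ sumTo-as-sum n binomialTerm ⟨
  sumTo n binomialTerm         ∎
  where
  binomialTerm : ℕ → ℚ
  binomialTerm i = ℕ→ℚ (n C i) * (u ^ℚ i * v ^ℚ (n ∸ i))
  term : ∀ i → (n C i) × (u ^ i * v ^ (n ∸ i)) ≡ binomialTerm i
  term i = trans (×-as-ℕ→ℚ (n C i) _) (cong (ℕ→ℚ (n C i) *_) (cong₂ _*_ (^-as-^ℚ u i) (^-as-^ℚ v (n ∸ i))))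

sign : ℕ → ℚ
sign t = (- 1ℚ) ^ℚ t

alternating-binomial : ∀ n u → sumTo n (λ i → ℕ→ℚ (n C i) * sign (n ∸ i) * u ^ℚ i) ≡ (u + - 1ℚ) ^ℚ n
alternating-binomial n u =
  trans (sum-cong n (λ i _ → reorder (ℕ→ℚ (n C i)) (sign (n ∸ i)) (u ^ℚ i)))
        (sym (binomial n u (- 1ℚ)))
  where
  reorder : ∀ c s t → c * s * t ≡ c * (t * s)
  reorder = solve-∀ ℚ-ring

absorption : ∀ k j → suc j ℕ.* (suc k C suc j) ≡ suc k ℕ.* (k C j)
absorption zero    zero    = refl
absorption zero    (suc j) =
  trans (cong (suc (suc j) ℕ.*_) (k>n⇒nCk≡0 {1} {suc (suc j)} (s≤s (s≤s z≤n)))) (ℕP.*-zeroʳ (suc (suc j)))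
absorption (suc k) zero    =
  trans (ℕP.*-identityˡ _) (trans (nC1≡n (suc (suc k))) (sym (ℕP.*-identityʳ (suc (suc k)))))
absorption (suc k) (suc j) = begin
  suc (suc j) ℕ.* (suc (suc k) C suc (suc j))
    ≡⟨ cong (suc (suc j) ℕ.*_) (nCk+nC[k+1]≡[n+1]C[k+1] (suc k) (suc j)) ⟨
  suc (suc j) ℕ.* (X ℕ.+ Y)
    ≡⟨ spread j X Y ⟩
  suc j ℕ.* X ℕ.+ suc (suc j) ℕ.* Y ℕ.+ X
    ≡⟨ cong₂ (λ p q → p ℕ.+ q ℕ.+ X) (absorption k j) (absorption k (suc j)) ⟩
  suc k ℕ.* (k C j) ℕ.+ suc k ℕ.* (k C suc j) ℕ.+ X
    ≡⟨ cong (ℕ._+ X) (ℕP.*-distribˡ-+ (suc k) (k C j) (k C suc j)) ⟨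
  suc k ℕ.* (k C j ℕ.+ k C suc j) ℕ.+ X
    ≡⟨ cong (λ t → suc k ℕ.* t ℕ.+ X) (nCk+nC[k+1]≡[n+1]C[k+1] k j) ⟩
  suc k ℕ.* X ℕ.+ X
    ≡⟨ ℕP.+-comm (suc k ℕ.* X) X ⟩
  suc (suc k) ℕ.* X ∎
  where
  X Y : ℕ
  X = suc k C suc j
  Y = suc k C suc (suc j)
  spread : ∀ j X Y → suc (suc j) ℕ.* (X ℕ.+ Y) ≡ suc j ℕ.* X ℕ.+ suc (suc j) ℕ.* Y ℕ.+ X
  spread = ℕ-Solver.solve-∀

weighted-pascal : ∀ k j → j ℕ.* (suc k C j) ℕ.+ suc k ℕ.* (k C j) ≡ suc k ℕ.* (suc k C j)
weighted-pascal k zero    = refl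
weighted-pascal k (suc j) = begin
  suc j ℕ.* (suc k C suc j) ℕ.+ suc k ℕ.* (k C suc j)
    ≡⟨ cong (ℕ._+ suc k ℕ.* (k C suc j)) (absorption k j) ⟩
  suc k ℕ.* (k C j) ℕ.+ suc k ℕ.* (k C suc j)
    ≡⟨ ℕP.*-distribˡ-+ (suc k) (k C j) (k C suc j) ⟨
  suc k ℕ.* (k C j ℕ.+ k C suc j)
    ≡⟨ cong (suc k ℕ.*_) (nCk+nC[k+1]≡[n+1]C[k+1] k j) ⟩
  suc k ℕ.* (suc k C suc j) ∎

difference-coefficients : ∀ a b k j →
  (suc k C j) ℕ.* (a ℕ.* j ℕ.+ b) ℕ.+ (a ℕ.* suc k) ℕ.* (k C j) ≡ (b ℕ.+ a ℕ.* suc k) ℕ.* (suc k C j)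
difference-coefficients a b k j = begin
  P ℕ.* (a ℕ.* j ℕ.+ b) ℕ.+ (a ℕ.* suc k) ℕ.* T  ≡⟨ gather a b j (suc k) P T ⟩
  a ℕ.* (j ℕ.* P ℕ.+ suc k ℕ.* T) ℕ.+ b ℕ.* P   ≡⟨ cong (λ t → a ℕ.* t ℕ.+ b ℕ.* P) (weighted-pascal k j) ⟩
  a ℕ.* (suc k ℕ.* P) ℕ.+ b ℕ.* P               ≡⟨ factor a b (suc k) P ⟩
  (b ℕ.+ a ℕ.* suc k) ℕ.* P                     ∎
  where
  P T : ℕ
  P = suc k C j
  T = k C j
  gather : ∀ a b j K P T →
           P ℕ.* (a ℕ.* j ℕ.+ b) ℕ.+ (a ℕ.* K) ℕ.* T ≡ a ℕ.* (j ℕ.* P ℕ.+ K ℕ.* T) ℕ.+ b ℕ.* P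
  gather = ℕ-Solver.solve-∀
  factor : ∀ a b K P → a ℕ.* (K ℕ.* P) ℕ.+ b ℕ.* P ≡ (b ℕ.+ a ℕ.* K) ℕ.* P
  factor = ℕ-Solver.solve-∀

Δ : ℕ → ℕ → ℕ → ℕ → ℚ
Δ a b n k = sumTo k (λ j → ℕ→ℚ (k C j) * sign (k ∸ j) * ℕ→ℚ (a ℕ.* j ℕ.+ b) ^ℚ n)

Δ-constant : ∀ a b k → Δ a b 0 (suc k) ≡ 0ℚ
Δ-constant a b k = begin
  Δ a b 0 (suc k)
    ≡⟨ sum-cong (suc k) (λ j _ → cong (ℕ→ℚ (suc k C j) * sign (suc k ∸ j) *_) (1^n≡1 j)) ⟨
  sumTo (suc k) (λ j → ℕ→ℚ (suc k C j) * sign (suc k ∸ j) * 1ℚ ^ℚ j)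
    ≡⟨ alternating-binomial (suc k) 1ℚ ⟩
  (1ℚ + - 1ℚ) ^ℚ suc k
    ≡⟨ *-zeroˡ ((1ℚ + - 1ℚ) ^ℚ k) ⟩
  0ℚ ∎

-- Raising the order of the sign by one negates an alternating sum; the extra top term
-- carries the coefficient C(k,k+1) = 0.
raise-sign-order : ∀ k (g : ℕ → ℚ) →
  sumTo (suc k) (λ j → ℕ→ℚ (k C j) * sign (suc k ∸ j) * g j) ≡
  - sumTo k (λ j → ℕ→ℚ (k C j) * sign (k ∸ j) * g j)
raise-sign-order k g = begin
  sumTo k F + ℕ→ℚ (k C suc k) * sign (k ∸ k) * g (suc k)
    ≡⟨ cong (λ c → sumTo k F + ℕ→ℚ c * sign (k ∸ k) * g (suc k)) (k>n⇒nCk≡0 (ℕP.n<1+n k)) ⟩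
  sumTo k F + 0ℚ * sign (k ∸ k) * g (suc k)
    ≡⟨ drop-zero-term (sumTo k F) (sign (k ∸ k)) (g (suc k)) ⟩
  sumTo k F
    ≡⟨ sum-cong k (λ j j≤k → lower j j≤k) ⟩
  sumTo k (λ j → - 1ℚ * G j)
    ≡⟨ sum-*ˡ k (- 1ℚ) G ⟨
  - 1ℚ * sumTo k G
    ≡⟨ -1*x≈-x (sumTo k G) ⟩
  - sumTo k G ∎
  where
  F G : ℕ → ℚ
  F j = ℕ→ℚ (k C j) * sign (suc k ∸ j) * g j
  G j = ℕ→ℚ (k C j) * sign (k ∸ j) * g j
  pull-sign : ∀ c s g → c * (- 1ℚ * s) * g ≡ - 1ℚ * (c * s * g)
  pull-sign = solve-∀ ℚ-ring
  lower : ∀ j → j ≤ k → F j ≡ - 1ℚ * G j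
  lower j j≤k = begin
    ℕ→ℚ (k C j) * sign (suc k ∸ j) * g j
      ≡⟨ cong (λ t → ℕ→ℚ (k C j) * sign t * g j) (ℕP.+-∸-assoc 1 j≤k) ⟩
    ℕ→ℚ (k C j) * (- 1ℚ * sign (k ∸ j)) * g j
      ≡⟨ pull-sign (ℕ→ℚ (k C j)) (sign (k ∸ j)) (g j) ⟩
    - 1ℚ * G j ∎
  drop-zero-term : ∀ a s g → a + 0ℚ * s * g ≡ a
  drop-zero-term = solve-∀ ℚ-ring

Δ-rec : ∀ a b n k →
  Δ a b (suc n) (suc k) ≡ ℕ→ℚ (b ℕ.+ a ℕ.* suc k) * Δ a b n (suc k) + ℕ→ℚ (a ℕ.* suc k) * Δ a b n k
Δ-rec a b n k = begin
  Δ a b (suc n) (suc k)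
    ≡⟨ sum-cong (suc k) (λ j _ → split j) ⟩
  sumTo (suc k) (λ j → U * (P j * s j * g j) + - R * (T j * s j * g j))
    ≡⟨ sum-+ (suc k) _ _ ⟩
  sumTo (suc k) (λ j → U * (P j * s j * g j)) + sumTo (suc k) (λ j → - R * (T j * s j * g j))
    ≡⟨ cong₂ _+_ (sum-*ˡ (suc k) U _) (sum-*ˡ (suc k) (- R) _) ⟨
  U * Δ a b n (suc k) + - R * sumTo (suc k) (λ j → T j * s j * g j)
    ≡⟨ cong (λ t → U * Δ a b n (suc k) + - R * t) (raise-sign-order k g) ⟩
  U * Δ a b n (suc k) + - R * - Δ a b n k
    ≡⟨ cong (λ t → U * Δ a b n (suc k) + t) (neg-*-neg R (Δ a b n k)) ⟩
  U * Δ a b n (suc k) + R * Δ a b n k ∎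
  where
  U R : ℚ
  U = ℕ→ℚ (b ℕ.+ a ℕ.* suc k)
  R = ℕ→ℚ (a ℕ.* suc k)
  P T e g s : ℕ → ℚ
  P j = ℕ→ℚ (suc k C j)
  T j = ℕ→ℚ (k C j)
  e j = ℕ→ℚ (a ℕ.* j ℕ.+ b)
  g j = e j ^ℚ n
  s j = sign (suc k ∸ j)
  coefficients : ∀ j → P j * e j + R * T j ≡ U * P j
  coefficients j = begin
    P j * e j + R * T j  ≡⟨ ℕ→ℚ-bilinear (suc k C j) (a ℕ.* j ℕ.+ b) (a ℕ.* suc k) (k C j) ⟩
    ℕ→ℚ ((suc k C j) ℕ.* (a ℕ.* j ℕ.+ b) ℕ.+ (a ℕ.* suc k) ℕ.* (k C j))
                         ≡⟨ cong ℕ→ℚ (difference-coefficients a b k j) ⟩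
    ℕ→ℚ ((b ℕ.+ a ℕ.* suc k) ℕ.* (suc k C j))
                         ≡⟨ ℕ→ℚ-* (b ℕ.+ a ℕ.* suc k) (suc k C j) ⟩
    U * P j              ∎
  expand : ∀ p s e g r t → p * s * (e * g) ≡ (p * e + r * t) * s * g + - r * (t * s * g)
  expand = solve-∀ ℚ-ring
  reassoc : ∀ u p s g → u * p * s * g ≡ u * (p * s * g)
  reassoc = solve-∀ ℚ-ring
  -- each term of Δ(n+1,k+1) splits along  (aj+b) C(k+1,j) = U C(k+1,j) - R C(k,j)
  split : ∀ j → P j * s j * (e j * g j) ≡ U * (P j * s j * g j) + - R * (T j * s j * g j)
  split j = begin
    P j * s j * (e j * g j)
      ≡⟨ expand (P j) (s j) (e j) (g j) R (T j) ⟩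
    (P j * e j + R * T j) * s j * g j + - R * (T j * s j * g j)
      ≡⟨ cong (λ c → c * s j * g j + - R * (T j * s j * g j)) (coefficients j) ⟩
    U * P j * s j * g j + - R * (T j * s j * g j)
      ≡⟨ cong (_+ - R * (T j * s j * g j)) (reassoc U (P j) (s j) (g j)) ⟩
    U * (P j * s j * g j) + - R * (T j * s j * g j) ∎
  neg-*-neg : ∀ r d → - r * - d ≡ r * d
  neg-*-neg = solve-∀ ℚ-ring

Δ-vanish : ∀ a b n k → n < k → Δ a b n k ≡ 0ℚ
Δ-vanish a b zero    (suc k) _         = Δ-constant a b k
Δ-vanish a b (suc n) (suc k) (s≤s n<k) = begin
  Δ a b (suc n) (suc k)
    ≡⟨ Δ-rec a b n k ⟩
  U * Δ a b n (suc k) + R * Δ a b n k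
    ≡⟨ cong₂ (λ x y → U * x + R * y) (Δ-vanish a b n (suc k) (ℕP.m<n⇒m<1+n n<k)) (Δ-vanish a b n k n<k) ⟩
  U * 0ℚ + R * 0ℚ
    ≡⟨ cong₂ _+_ (*-zeroʳ U) (*-zeroʳ R) ⟩
  0ℚ ∎
  where
  U R : ℚ
  U = ℕ→ℚ (b ℕ.+ a ℕ.* suc k)
  R = ℕ→ℚ (a ℕ.* suc k)

Δ-stirling : ∀ n k → Δ 1 0 n k ≡ ℕ→ℚ (k ! ℕ.* S n k)
Δ-stirling zero    zero    = refl
Δ-stirling zero    (suc k) = trans (Δ-constant 1 0 k) (cong ℕ→ℚ (sym (ℕP.*-zeroʳ (suc k !))))
Δ-stirling (suc n) zero    = cong (1ℚ * 1ℚ *_) (*-zeroˡ (ℕ→ℚ 0 ^ℚ n))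
Δ-stirling (suc n) (suc k) = begin
  Δ 1 0 (suc n) (suc k)
    ≡⟨ Δ-rec 1 0 n k ⟩
  ℕ→ℚ (0 ℕ.+ 1 ℕ.* suc k) * Δ 1 0 n (suc k) + ℕ→ℚ (1 ℕ.* suc k) * Δ 1 0 n k
    ≡⟨ cong₂ (λ x y → ℕ→ℚ (0 ℕ.+ 1 ℕ.* suc k) * x + ℕ→ℚ (1 ℕ.* suc k) * y)
             (Δ-stirling n (suc k)) (Δ-stirling n k) ⟩
  ℕ→ℚ (0 ℕ.+ 1 ℕ.* suc k) * ℕ→ℚ (suc k ! ℕ.* S n (suc k)) + ℕ→ℚ (1 ℕ.* suc k) * ℕ→ℚ (k ! ℕ.* S n k)
    ≡⟨ ℕ→ℚ-bilinear (0 ℕ.+ 1 ℕ.* suc k) (suc k ! ℕ.* S n (suc k)) (1 ℕ.* suc k) (k ! ℕ.* S n k) ⟩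
  ℕ→ℚ ((0 ℕ.+ 1 ℕ.* suc k) ℕ.* (suc k ! ℕ.* S n (suc k)) ℕ.+ (1 ℕ.* suc k) ℕ.* (k ! ℕ.* S n k))
    ≡⟨ cong ℕ→ℚ (stirling-step (suc k) (k !) (S n (suc k)) (S n k)) ⟩
  ℕ→ℚ (suc k ! ℕ.* S (suc n) (suc k)) ∎
  where
  -- the recurrence S(n+1,k+1) = (k+1) S(n,k+1) + S(n,k), multiplied by (k+1)!
  stirling-step : ∀ K k! A B → (0 ℕ.+ 1 ℕ.* K) ℕ.* ((K ℕ.* k!) ℕ.* A) ℕ.+ (1 ℕ.* K) ℕ.* (k! ℕ.* B) ≡
                               (K ℕ.* k!) ℕ.* (K ℕ.* A ℕ.+ B)
  stirling-step = ℕ-Solver.solve-∀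

Δ-shift-inversion : ∀ a b n k →
  sumTo n (λ i → ℕ→ℚ (n C i) * sign (n ∸ i) * Δ a (suc b) i k) ≡ Δ a b n k
Δ-shift-inversion a b n k = begin
  sumTo n (λ i → c i * sumTo k (λ j → d j * e j ^ℚ i))
    ≡⟨ sum-swap-weighted n k c (λ i j → d j * e j ^ℚ i) ⟩
  sumTo k (λ j → sumTo n (λ i → c i * (d j * e j ^ℚ i)))
    ≡⟨ sum-cong k (λ j _ → pull-out j) ⟩
  sumTo k (λ j → d j * sumTo n (λ i → c i * e j ^ℚ i))
    ≡⟨ sum-cong k (λ j _ → cong (d j *_) (alternating-binomial n (e j))) ⟩
  sumTo k (λ j → d j * (e j + - 1ℚ) ^ℚ n)
    ≡⟨ sum-cong k (λ j _ → cong (λ t → d j * t ^ℚ n) (unshift j)) ⟩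
  Δ a b n k ∎
  where
  c d e : ℕ → ℚ
  c i = ℕ→ℚ (n C i) * sign (n ∸ i)
  d j = ℕ→ℚ (k C j) * sign (k ∸ j)
  e j = ℕ→ℚ (a ℕ.* j ℕ.+ suc b)
  pull-out : ∀ j → sumTo n (λ i → c i * (d j * e j ^ℚ i)) ≡ d j * sumTo n (λ i → c i * e j ^ℚ i)
  pull-out j = trans (sum-cong n (λ i _ → x∙yz≈y∙xz (c i) (d j) (e j ^ℚ i)))
                     (sym (sum-*ˡ n (d j) (λ i → c i * e j ^ℚ i)))
  cancel-one : ∀ t → 1ℚ + t + - 1ℚ ≡ t
  cancel-one = solve-∀ ℚ-ring
  unshift : ∀ j → e j + - 1ℚ ≡ ℕ→ℚ (a ℕ.* j ℕ.+ b)
  unshift j = begin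
    e j + - 1ℚ                             ≡⟨ cong (λ t → ℕ→ℚ t + - 1ℚ) (ℕP.+-suc (a ℕ.* j) b) ⟩
    ℕ→ℚ (1 ℕ.+ (a ℕ.* j ℕ.+ b)) + - 1ℚ    ≡⟨ cong (_+ - 1ℚ) (ℕ→ℚ-+ 1 (a ℕ.* j ℕ.+ b)) ⟩
    1ℚ + ℕ→ℚ (a ℕ.* j ℕ.+ b) + - 1ℚ       ≡⟨ cancel-one (ℕ→ℚ (a ℕ.* j ℕ.+ b)) ⟩
    ℕ→ℚ (a ℕ.* j ℕ.+ b)                    ∎

Δ-scale : ∀ a n k → Δ a 0 n k ≡ ℕ→ℚ a ^ℚ n * Δ 1 0 n k
Δ-scale a n k = trans (sum-cong k (λ j _ → scale j)) (sym (sum-*ˡ k (ℕ→ℚ a ^ℚ n) _))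
  where
  linear : ∀ a j → a ℕ.* j ℕ.+ 0 ≡ a ℕ.* (1 ℕ.* j ℕ.+ 0)
  linear = ℕ-Solver.solve-∀
  power : ∀ j → ℕ→ℚ (a ℕ.* j ℕ.+ 0) ^ℚ n ≡ ℕ→ℚ a ^ℚ n * ℕ→ℚ (1 ℕ.* j ℕ.+ 0) ^ℚ n
  power j = begin
    ℕ→ℚ (a ℕ.* j ℕ.+ 0) ^ℚ n              ≡⟨ cong (λ t → ℕ→ℚ t ^ℚ n) (linear a j) ⟩
    ℕ→ℚ (a ℕ.* (1 ℕ.* j ℕ.+ 0)) ^ℚ n      ≡⟨ cong (_^ℚ n) (ℕ→ℚ-* a (1 ℕ.* j ℕ.+ 0)) ⟩
    (ℕ→ℚ a * ℕ→ℚ (1 ℕ.* j ℕ.+ 0)) ^ℚ n    ≡⟨ ^ℚ-distrib-* (ℕ→ℚ a) (ℕ→ℚ (1 ℕ.* j ℕ.+ 0)) n ⟩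
    ℕ→ℚ a ^ℚ n * ℕ→ℚ (1 ℕ.* j ℕ.+ 0) ^ℚ n ∎
  scale : ∀ j → ℕ→ℚ (k C j) * sign (k ∸ j) * ℕ→ℚ (a ℕ.* j ℕ.+ 0) ^ℚ n ≡
                ℕ→ℚ a ^ℚ n * (ℕ→ℚ (k C j) * sign (k ∸ j) * ℕ→ℚ (1 ℕ.* j ℕ.+ 0) ^ℚ n)
  scale j = trans (cong (ℕ→ℚ (k C j) * sign (k ∸ j) *_) (power j))
                  (x∙yz≈y∙xz (ℕ→ℚ (k C j) * sign (k ∸ j)) (ℕ→ℚ a ^ℚ n) (ℕ→ℚ (1 ℕ.* j ℕ.+ 0) ^ℚ n))

D-extend : ∀ m .{{_ : NonZero m}} {i} n x → i ≤ n → D m i x ≡ sumTo n (λ k → W m i k * x ^ℚ k)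
D-extend m {i} n x = sum-extend n _ W-vanish
  where
  W-vanish : ∀ k → i < k → W m i k * x ^ℚ k ≡ 0ℚ
  W-vanish k i<k = begin
    inv-mk! * Δ m 1 i k * x ^ℚ k  ≡⟨ cong (λ t → inv-mk! * t * x ^ℚ k) (Δ-vanish m 1 i k i<k) ⟩
    inv-mk! * 0ℚ * x ^ℚ k         ≡⟨ cong (_* x ^ℚ k) (*-zeroʳ inv-mk!) ⟩
    0ℚ * x ^ℚ k                   ≡⟨ *-zeroˡ (x ^ℚ k) ⟩
    0ℚ                            ∎
    where
    inv-mk! : ℚ
    inv-mk! = inv (m ℕ.^ k ℕ.* k !) {{m*n≢0 _ _ {{m^n≢0 m k}} {{k !≢0}}}}

alternating-W : ∀ m .{{_ : NonZero m}} n k →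
  sumTo n (λ i → ℕ→ℚ (n C i) * sign (n ∸ i) * W m i k) ≡ ℕ→ℚ (m ℕ.^ n) * (ℕ→ℚ (S n k) * inv m ^ℚ k)
alternating-W m n k = begin
  sumTo n (λ i → c i * (iW * Δ m 1 i k))
    ≡⟨ sum-cong n (λ i _ → x∙yz≈y∙xz (c i) iW (Δ m 1 i k)) ⟩
  sumTo n (λ i → iW * (c i * Δ m 1 i k))
    ≡⟨ sum-*ˡ n iW _ ⟨
  iW * sumTo n (λ i → c i * Δ m 1 i k)
    ≡⟨ cong (iW *_) (Δ-shift-inversion m 0 n k) ⟩
  iW * Δ m 0 n k
    ≡⟨ cong (iW *_) (trans (Δ-scale m n k) (cong₂ _*_ (sym (ℕ→ℚ-^ m n)) (Δ-stirling n k))) ⟩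
  iW * (ℕ→ℚ (m ℕ.^ n) * ℕ→ℚ (k ! ℕ.* S n k))
    ≡⟨ cong₂ (λ p q → p * (ℕ→ℚ (m ℕ.^ n) * q)) iW-split (ℕ→ℚ-* (k !) (S n k)) ⟩
  inv m ^ℚ k * inv (k !) {{k !≢0}} * (ℕ→ℚ (m ℕ.^ n) * (ℕ→ℚ (k !) * ℕ→ℚ (S n k)))
    ≡⟨ regroup (inv m ^ℚ k) (inv (k !) {{k !≢0}}) (ℕ→ℚ (m ℕ.^ n)) (ℕ→ℚ (k !)) (ℕ→ℚ (S n k)) ⟩
  ℕ→ℚ (m ℕ.^ n) * (ℕ→ℚ (S n k) * inv m ^ℚ k) * (inv (k !) {{k !≢0}} * ℕ→ℚ (k !))
    ≡⟨ cong (ℕ→ℚ (m ℕ.^ n) * (ℕ→ℚ (S n k) * inv m ^ℚ k) *_) (inv-cancel (k !) {{k !≢0}}) ⟩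
  ℕ→ℚ (m ℕ.^ n) * (ℕ→ℚ (S n k) * inv m ^ℚ k) * 1ℚ
    ≡⟨ *-identityʳ _ ⟩
  ℕ→ℚ (m ℕ.^ n) * (ℕ→ℚ (S n k) * inv m ^ℚ k) ∎
  where
  c : ℕ → ℚ
  c i = ℕ→ℚ (n C i) * sign (n ∸ i)
  iW : ℚ
  iW = inv (m ℕ.^ k ℕ.* k !) {{m*n≢0 _ _ {{m^n≢0 m k}} {{k !≢0}}}}
  iW-split : iW ≡ inv m ^ℚ k * inv (k !) {{k !≢0}}
  iW-split = trans (inv-* (m ℕ.^ k) (k !) {{m^n≢0 m k}} {{k !≢0}} {{m*n≢0 _ _ {{m^n≢0 m k}} {{k !≢0}}}})
                   (cong (_* inv (k !) {{k !≢0}}) (inv-^ m k))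
  regroup : ∀ q f M F s → q * f * (M * (F * s)) ≡ M * (s * q) * (f * F)
  regroup = solve-∀ ℚ-ring

alternating-D : ∀ m .{{_ : NonZero m}} n x →
  sumTo n (λ i → ℕ→ℚ (n C i) * sign (n ∸ i) * D m i x) ≡
  sumTo n (λ k → ℕ→ℚ (m ℕ.^ n) * (ℕ→ℚ (S n k) * inv m ^ℚ k) * x ^ℚ k)
alternating-D m n x = begin
  sumTo n (λ i → c i * D m i x)
    ≡⟨ sum-cong n (λ i i≤n → cong (c i *_) (D-extend m n x i≤n)) ⟩
  sumTo n (λ i → c i * sumTo n (λ k → W m i k * x ^ℚ k))
    ≡⟨ sum-swap-weighted n n c (λ i k → W m i k * x ^ℚ k) ⟩
  sumTo n (λ k → sumTo n (λ i → c i * (W m i k * x ^ℚ k)))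
    ≡⟨ sum-cong n (λ k _ → coefficient k) ⟩
  sumTo n (λ k → ℕ→ℚ (m ℕ.^ n) * (ℕ→ℚ (S n k) * inv m ^ℚ k) * x ^ℚ k) ∎
  where
  c : ℕ → ℚ
  c i = ℕ→ℚ (n C i) * sign (n ∸ i)
  coefficient : ∀ k → sumTo n (λ i → c i * (W m i k * x ^ℚ k)) ≡
                      ℕ→ℚ (m ℕ.^ n) * (ℕ→ℚ (S n k) * inv m ^ℚ k) * x ^ℚ k
  coefficient k = begin
    sumTo n (λ i → c i * (W m i k * x ^ℚ k))
      ≡⟨ sum-cong n (λ i _ → x∙yz≈z∙xy (c i) (W m i k) (x ^ℚ k)) ⟩
    sumTo n (λ i → x ^ℚ k * (c i * W m i k))
      ≡⟨ sum-*ˡ n (x ^ℚ k) _ ⟨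
    x ^ℚ k * sumTo n (λ i → c i * W m i k)
      ≡⟨ cong (x ^ℚ k *_) (alternating-W m n k) ⟩
    x ^ℚ k * (ℕ→ℚ (m ℕ.^ n) * (ℕ→ℚ (S n k) * inv m ^ℚ k))
      ≡⟨ *-comm (x ^ℚ k) _ ⟩
    ℕ→ℚ (m ℕ.^ n) * (ℕ→ℚ (S n k) * inv m ^ℚ k) * x ^ℚ k ∎

mainTheorem5 : (m : ℕ) → .{{_ : NonZero m}} → (n : ℕ) → (x : ℚ) →
    φ n (x * inv m) ≡
      inv (m Data.Nat.^ n) {{m^n≢0 m n}} * sumTo n (λ i → ℕ→ℚ (n C i) * ((- 1ℚ) ^ℚ (n ∸ i)) * D m i x)
mainTheorem5 m n x = sym (begin
  iM * sumTo n (λ i → ℕ→ℚ (n C i) * sign (n ∸ i) * D m i x)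
    ≡⟨ cong (iM *_) (alternating-D m n x) ⟩
  iM * sumTo n (λ k → ℕ→ℚ (m ℕ.^ n) * (ℕ→ℚ (S n k) * inv m ^ℚ k) * x ^ℚ k)
    ≡⟨ sum-*ˡ n iM _ ⟩
  sumTo n (λ k → iM * (ℕ→ℚ (m ℕ.^ n) * (ℕ→ℚ (S n k) * inv m ^ℚ k) * x ^ℚ k))
    ≡⟨ sum-cong n (λ k _ → cancel k) ⟩
  φ n (x * inv m) ∎)
  where
  iM : ℚ
  iM = inv (m ℕ.^ n) {{m^n≢0 m n}}
  regroup : ∀ i M s q X → i * (M * (s * q) * X) ≡ i * M * (s * (X * q))
  regroup = solve-∀ ℚ-ring
  cancel : ∀ k → iM * (ℕ→ℚ (m ℕ.^ n) * (ℕ→ℚ (S n k) * inv m ^ℚ k) * x ^ℚ k) ≡ ℕ→ℚ (S n k) * (x * inv m) ^ℚ k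
  cancel k = begin
    iM * (ℕ→ℚ (m ℕ.^ n) * (ℕ→ℚ (S n k) * inv m ^ℚ k) * x ^ℚ k)
      ≡⟨ regroup iM (ℕ→ℚ (m ℕ.^ n)) (ℕ→ℚ (S n k)) (inv m ^ℚ k) (x ^ℚ k) ⟩
    iM * ℕ→ℚ (m ℕ.^ n) * (ℕ→ℚ (S n k) * (x ^ℚ k * inv m ^ℚ k))
      ≡⟨ cong₂ (λ p q → p * (ℕ→ℚ (S n k) * q))
               (inv-cancel (m ℕ.^ n) {{m^n≢0 m n}}) (sym (^ℚ-distrib-* x (inv m) k)) ⟩
    1ℚ * (ℕ→ℚ (S n k) * (x * inv m) ^ℚ k)
      ≡⟨ *-identityˡ _ ⟩
    ℕ→ℚ (S n k) * (x * inv m) ^ℚ k ∎
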